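{- Let $c \ge 1$ be an integer and let $G$ be an undirected multigraph with vertex set $V(G) = S \cup \mathcal{T}$, where $S \cap \mathcal{T} = \emptyset$, $\mathcal{T}$ is the set of terminals, and every terminal has degree exactly one and is adjacent to a vertex of $S$. Let $X \subseteq S$ be a connectivity-$c$ linked set in $G$. Then $G/X$ is a connectivity-$c$ mimicking network for $(G,\mathcal{T})$.
   Context: For $X \subseteq S$, $\partial(X) = E_G(X, V(G)\setminus X)$ denotes the set of edges with exactly one endpoint in $X$; $E_G(A,B)$ is the set of edges with one endpoint in $A$ and the other in $B$. A set $X \subseteq S$ is connectivity-$c$ linked in $G$ if for every partition $X = A \cup B$ into disjoint sets $A,B$ we have $|E_G(A,B)| \ge \min\big(|\partial(A)\cap\partial(X)|, |\partial(B)\cap\partial(X)|, c\big)$. $G/X$ denotes the graph obtained from $G$ by contracting every edge of $G[X]$. For disjoint vertex sets $A,B$, $\mathrm{mincut}_G(A,B)$ is the minimum number of edges whose removal separates $A$ from $B$ ($0$ if $A$ or $B$ is empty) and $\mathrm{mincut}^c_G(A,B)=\min\{\mathrm{mincut}_G(A,B),c\}$. A graph $H$ is a connectivity-$c$ mimicking network for $(G,\mathcal{T})$ if $V(H)$ contains at least one copy of each terminal and $\mathrm{mincut}^c_H(A,B)=\mathrm{mincut}^c_G(A,B)$ for all disjoint $A,B\subseteq\mathcal{T}$. -}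

module Defs where

open import Data.Nat using (ℕ; zero; suc; _≤_; _⊓_)
open import Data.Bool using (Bool; true; false; _∧_; _∨_; not; if_then_else_)
open import Data.Fin using (Fin; _≟_)
open import Data.List using (List; length; lookup; map; filterᵇ; allFin)
open import Data.Bool.ListAction using (any)
open import Data.Product using (Σ; _×_; _,_; proj₁; proj₂)
open import Data.Sum using (_⊎_)
open import Relation.Nullary using (¬_)
open import Relation.Nullary.Decidable using (⌊_⌋)
open import Relation.Binary.PropositionalEquality using (_≡_)
open import Function.Bundles using (_⇔_)
open import Function.Definitions using (Surjective)

-- A (finite, undirected) multigraph on vertex set Fin n: a list of edges,
-- each edge an unordered pair stored as an (arbitrarily oriented) pair.
-- Parallel edges (and loops) are allowed.
Graph : ℕ → Set
Graph n = List (Fin n × Fin n)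

VSet : ℕ → Set
VSet n = Fin n → Bool

Edge : ∀ {n} → Graph n → Set
Edge G = Fin (length G)

ESet : ∀ {n} → Graph n → Set
ESet G = Edge G → Bool

ends : ∀ {n} (G : Graph n) → Edge G → Fin n × Fin n
ends G e = lookup G e

countᵇ : ∀ {m} → (Fin m → Bool) → ℕ
countᵇ {m} p = length (filterᵇ p (allFin m))

countE : ∀ {n} (G : Graph n) → (Fin n → Fin n → Bool) → ℕ
countE G p = countᵇ (λ e → p (proj₁ (ends G e)) (proj₂ (ends G e)))

xor : Bool → Bool → Bool
xor a b = (a ∧ not b) ∨ (not a ∧ b)

crossesᵇ : ∀ {n} → VSet n → Fin n → Fin n → Bool
crossesᵇ Y u v = xor (Y u) (Y v)

∂size : ∀ {n} (G : Graph n) → VSet n → ℕ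
∂size G Y = countE G (crossesᵇ Y)

∂∩∂size : ∀ {n} (G : Graph n) → VSet n → VSet n → ℕ
∂∩∂size G A X = countE G (λ u v → crossesᵇ A u v ∧ crossesᵇ X u v)

Esize : ∀ {n} (G : Graph n) → VSet n → VSet n → ℕ
Esize G A B = countE G (λ u v → (A u ∧ B v) ∨ (B u ∧ A v))

-- degree (a loop counts twice)
deg : ∀ {n} (G : Graph n) → Fin n → ℕ
deg G t = countE G (λ u v → ⌊ u ≟ t ⌋) Data.Nat.+ countE G (λ u v → ⌊ v ≟ t ⌋)
  where import Data.Nat

_⊆_ : ∀ {n} → VSet n → VSet n → Set
A ⊆ B = ∀ v → A v ≡ true → B v ≡ true

Disjoint : ∀ {n} → VSet n → VSet n → Set
Disjoint A B = ∀ v → A v ≡ true → B v ≡ false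

IsPartition : ∀ {n} → VSet n → VSet n → VSet n → Set
IsPartition X A B = (∀ v → (A v ∨ B v) ≡ X v) × Disjoint A B

TerminalCondition : ∀ {n} (G : Graph n) (T : VSet n) → Set
TerminalCondition G T =
  ∀ t → T t ≡ true →
    (deg G t ≡ 1) ×
    Σ (Edge G) (λ e →
       ((proj₁ (ends G e) ≡ t) × (T (proj₂ (ends G e)) ≡ false))
     ⊎ ((proj₂ (ends G e) ≡ t) × (T (proj₁ (ends G e)) ≡ false)))

Linked : ∀ {n} (c : ℕ) (G : Graph n) (X : VSet n) → Set
Linked c G X = ∀ A B → IsPartition X A B →
  (∂∩∂size G A X ⊓ ∂∩∂size G B X) ⊓ c ≤ Esize G A B

data Reach {n} (G : Graph n) (F : ESet G) : Fin n → Fin n → Set where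
  here : ∀ {u} → Reach G F u u
  fwd  : ∀ {u w} (e : Edge G) → F e ≡ false →
         proj₁ (ends G e) ≡ u → Reach G F (proj₂ (ends G e)) w → Reach G F u w
  bwd  : ∀ {u w} (e : Edge G) → F e ≡ false →
         proj₂ (ends G e) ≡ u → Reach G F (proj₁ (ends G e)) w → Reach G F u w

Separates : ∀ {n} (G : Graph n) → ESet G → VSet n → VSet n → Set
Separates G F A B = ∀ a b → A a ≡ true → B b ≡ true → ¬ Reach G F a b

IsMincut : ∀ {n} (G : Graph n) → VSet n → VSet n → ℕ → Set
IsMincut G A B k =
  Σ (ESet G) (λ F → Separates G F A B × countᵇ F ≡ k)
  × (∀ F → Separates G F A B → k ≤ countᵇ F)

image : ∀ {n n'} → (Fin n → Fin n') → VSet n → VSet n'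
image {n} ι A y = any (λ t → A t ∧ ⌊ ι t ≟ y ⌋) (allFin n)

-- H is a connectivity-c mimicking network for (G,T), where ι t is the copy of
-- terminal t in H: mincut^c_H(A,B) = mincut^c_G(A,B) for disjoint A,B ⊆ T.
IsMimicking : ∀ {n n'} (c : ℕ) (G : Graph n) (T : VSet n)
              (H : Graph n') (ι : Fin n → Fin n') → Set
IsMimicking c G T H ι = ∀ A B → A ⊆ T → B ⊆ T → Disjoint A B →
  Σ ℕ (λ kG → Σ ℕ (λ kH →
    IsMincut G A B kG × IsMincut H (image ι A) (image ι B) kH × (kH ⊓ c ≡ kG ⊓ c)))

inXᵇ : ∀ {n} → VSet n → Fin n × Fin n → Bool
inXᵇ X (u , v) = X u ∧ X v

-- Vertices of G/X are the classes of the
-- equivalence "connected by a path in G[X]"; π is the quotient map, which is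
-- specified by: surjective, and π u ≡ π v iff u ≡ v or u,v are joined in G[X].
ConnIn : ∀ {n} (G : Graph n) (X : VSet n) → Fin n → Fin n → Set
ConnIn G X = Reach G (λ e → not (inXᵇ X (ends G e)))

IsContractionMap : ∀ {n n'} (G : Graph n) (X : VSet n) (π : Fin n → Fin n') → Set
IsContractionMap G X π =
  Surjective _≡_ _≡_ π × (∀ u v → (π u ≡ π v) ⇔ ((u ≡ v) ⊎ ConnIn G X u v))

contract : ∀ {n n'} (G : Graph n) (X : VSet n) (π : Fin n → Fin n') → Graph n'
contract G X π = map (λ e → π (proj₁ e) , π (proj₂ e)) (filterᵇ (λ e → not (inXᵇ X e)) G)

-- A minimum A–B edge cut is attained by a vertex set Y ⊇ A avoiding B: for any separating
-- edge set F, the vertices reachable from A in G − F form such a set with ∂Y ⊆ F.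
-- Cuts of G/X are the cuts of G that are constant on X, with the same boundary, so
-- mincut(G/X) ≥ mincut(G).  Conversely let Y be a minimum cut of G with |∂Y| < c.  The
-- edges between X ∩ Y and X ∖ Y all lie in ∂Y, so there are fewer than c of them, and
-- linkedness makes one side, say X ∩ Y, meet ∂X in at most that many edges.  Moving that
-- side across (Y ↦ Y ∖ X, or Y ↦ Y ∪ X for the other side) trades those edges of ∂X for
-- the edges between the two sides, so |∂Y| does not grow and Y becomes constant on X,
-- i.e. a cut of G/X.

module Submission where

open import Defs
open import Data.Nat using (ℕ; _≥_; zero; suc; _+_; _≤_; _<_; _≤ᵇ_; _⊓_; z≤n; s≤s; _≤?_)
open import Data.Nat.Properties
  using ( ≤-refl; ≤-trans; ≤-reflexive; ≤-antisym; ≤-total; ≤-<-trans; <⇒≱; ≰⇒>; ≤ᵇ⇒≤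
        ; +-mono-≤; +-monoʳ-≤; +-mono-≤-<; +-cancelʳ-≤
        ; ⊓-sel; m≥n⇒m⊓n≡n; +-commutativeSemigroup; module ≤-Reasoning)
open import Algebra.Properties.CommutativeSemigroup +-commutativeSemigroup using (interchange)
open import Data.Fin using (Fin; zero; suc; _≟_)
open import Data.Fin.Properties using (any?)
open import Data.Bool using (Bool; true; false; _∧_; _∨_; not; T)
open import Data.Bool.Properties using (T-≡; T-∧; ¬-not; ∧-zeroʳ; ∨-zeroʳ)
import Data.Bool.Properties as Bool
open import Data.List using (List; []; _∷_; length; lookup; map; filterᵇ; allFin)
open import Data.List.Properties using (map-tabulate; tabulate-lookup)
open import Data.List.Relation.Unary.Any using (here; there; satisfied)
open import Data.List.Relation.Unary.Any.Properties using (any⁺; any⁻)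
open import Data.List.Membership.Propositional using (_∈_; lose)
open import Data.List.Membership.Propositional.Properties using (∈-allFin)
import Data.Vec.Functional as V
import Data.Product as Product
open import Data.Product using (∃-syntax; _×_; _,_; proj₁; proj₂; uncurry; map₂)
open import Data.Sum using (_⊎_; inj₁; inj₂; [_,_]′)
import Data.Sum as Sum
open import Function using (_∘_; id)
open import Function.Bundles using (_⇔_; mk⇔; Equivalence)
open import Induction.WellFounded using (Acc; acc)
open import Data.Nat.Induction using (<-wellFounded)
open import Relation.Nullary using (yes; no; contradiction)
open import Relation.Nullary.Decidable using (⌊_⌋; _×-dec_; toWitness; fromWitness)
open import Relation.Binary.Core using (_Preserves_⟶_)
open import Relation.Binary.PropositionalEquality
  using (_≡_; _≗_; refl; sym; trans; cong; cong₂; subst; module ≡-Reasoning)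

𝟙 : Bool → ℕ
𝟙 true  = 1
𝟙 false = 0

𝟙-mono : ∀ {a b} → (a ≡ true → b ≡ true) → 𝟙 a ≤ 𝟙 b
𝟙-mono {false}         _   = z≤n
𝟙-mono {true} {true}   _   = ≤-refl
𝟙-mono {true} {false}  a⇒b with () ← a⇒b refl

-- Chosen so that countᵇ p and countE G P are instances of count (allFin _) by definition.
count : {A : Set} → (A → Bool) → List A → ℕ
count p xs = length (filterᵇ p xs)

module _ {A : Set} where

  count-cons : ∀ (p : A → Bool) x xs → count p (x ∷ xs) ≡ 𝟙 (p x) + count p xs
  count-cons p x xs with p x
  ... | true  = refl
  ... | false = refl

  count-cong : ∀ {p q : A → Bool} → p ≗ q → ∀ xs → count p xs ≡ count q xs
  count-cong p≗q []       = refl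
  count-cong {p} {q} p≗q (x ∷ xs) = begin
    count p (x ∷ xs)      ≡⟨ count-cons p x xs ⟩
    𝟙 (p x) + count p xs  ≡⟨ cong₂ _+_ (cong 𝟙 (p≗q x)) (count-cong p≗q xs) ⟩
    𝟙 (q x) + count q xs  ≡⟨ count-cons q x xs ⟨
    count q (x ∷ xs)      ∎
    where open ≡-Reasoning

  count-mono : ∀ {p q : A → Bool} → (∀ x → 𝟙 (p x) ≤ 𝟙 (q x)) →
               ∀ xs → count p xs ≤ count q xs
  count-mono p≤q []       = z≤n
  count-mono {p} {q} p≤q (x ∷ xs) = begin
    count p (x ∷ xs)      ≡⟨ count-cons p x xs ⟩
    𝟙 (p x) + count p xs  ≤⟨ +-mono-≤ (p≤q x) (count-mono p≤q xs) ⟩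
    𝟙 (q x) + count q xs  ≡⟨ count-cons q x xs ⟨
    count q (x ∷ xs)      ∎
    where open ≤-Reasoning

  count-< : ∀ {p q : A → Bool} → (∀ x → 𝟙 (p x) ≤ 𝟙 (q x)) →
            ∀ {x xs} → x ∈ xs → p x ≡ false → q x ≡ true → count p xs < count q xs
  count-< {p} {q} p≤q {x} {_ ∷ xs} (here refl) px qx = begin-strict
    count p (x ∷ xs)      ≡⟨ count-cons p x xs ⟩
    𝟙 (p x) + count p xs  ≡⟨ cong (λ b → 𝟙 b + count p xs) px ⟩
    count p xs            <⟨ s≤s (count-mono p≤q xs) ⟩
    𝟙 true + count q xs   ≡⟨ cong (λ b → 𝟙 b + count q xs) qx ⟨
    𝟙 (q x) + count q xs  ≡⟨ count-cons q x xs ⟨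
    count q (x ∷ xs)      ∎
    where open ≤-Reasoning
  count-< {p} {q} p≤q {_} {y ∷ xs} (there x∈xs) px qx = begin-strict
    count p (y ∷ xs)      ≡⟨ count-cons p y xs ⟩
    𝟙 (p y) + count p xs  <⟨ +-mono-≤-< (p≤q y) (count-< p≤q x∈xs px qx) ⟩
    𝟙 (q y) + count q xs  ≡⟨ count-cons q y xs ⟨
    count q (y ∷ xs)      ∎
    where open ≤-Reasoning

  count-+-mono : ∀ {p q r s : A → Bool} →
                 (∀ x → 𝟙 (p x) + 𝟙 (q x) ≤ 𝟙 (r x) + 𝟙 (s x)) →
                 ∀ xs → count p xs + count q xs ≤ count r xs + count s xs
  count-+-mono h []       = z≤n
  count-+-mono {p} {q} {r} {s} h (x ∷ xs) = begin
    count p (x ∷ xs) + count q (x ∷ xs)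
      ≡⟨ cong₂ _+_ (count-cons p x xs) (count-cons q x xs) ⟩
    (𝟙 (p x) + count p xs) + (𝟙 (q x) + count q xs)
      ≡⟨ interchange (𝟙 (p x)) _ _ _ ⟩
    (𝟙 (p x) + 𝟙 (q x)) + (count p xs + count q xs)
      ≤⟨ +-mono-≤ (h x) (count-+-mono h xs) ⟩
    (𝟙 (r x) + 𝟙 (s x)) + (count r xs + count s xs)
      ≡⟨ interchange (𝟙 (r x)) _ _ _ ⟩
    (𝟙 (r x) + count r xs) + (𝟙 (s x) + count s xs)
      ≡⟨ cong₂ _+_ (count-cons r x xs) (count-cons s x xs) ⟨
    count r (x ∷ xs) + count s (x ∷ xs)
      ∎
    where open ≤-Reasoning

  count-filterᵇ : ∀ (p q : A → Bool) xs → count p (filterᵇ q xs) ≡ count (λ x → q x ∧ p x) xs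
  count-filterᵇ p q []       = refl
  count-filterᵇ p q (x ∷ xs) with q x
  ... | false = count-filterᵇ p q xs
  ... | true  with p x
  ...   | true  = cong suc (count-filterᵇ p q xs)
  ...   | false = count-filterᵇ p q xs

count-map : ∀ {A B : Set} (p : B → Bool) (f : A → B) xs → count p (map f xs) ≡ count (p ∘ f) xs
count-map p f []       = refl
count-map p f (x ∷ xs) with p (f x)
... | true  = cong suc (count-map p f xs)
... | false = count-map p f xs

count-lookup : ∀ {A : Set} (p : A → Bool) xs → count (p ∘ lookup xs) (allFin (length xs)) ≡ count p xs
count-lookup p xs = begin
  count (p ∘ lookup xs) (allFin (length xs))  ≡⟨ count-map p (lookup xs) (allFin (length xs)) ⟨
  count p (map (lookup xs) (allFin (length xs)))
    ≡⟨ cong (count p) (trans (map-tabulate id (lookup xs)) (tabulate-lookup xs)) ⟩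
  count p xs                                  ∎
  where open ≡-Reasoning

allᵇ : (Bool → Bool) → Bool
allᵇ p = p false ∧ p true

allᵇ-sound : ∀ p → T (allᵇ p) → ∀ b → T (p b)
allᵇ-sound p t false = proj₁ (Equivalence.to T-∧ t)
allᵇ-sound p t true  = proj₂ (Equivalence.to T-∧ t)

all⁴ : (Bool → Bool → Bool → Bool → Bool) → Bool
all⁴ p = allᵇ λ a → allᵇ λ b → allᵇ λ c → allᵇ (p a b c)

all⁴-sound : ∀ p → T (all⁴ p) → ∀ a b c d → T (p a b c d)
all⁴-sound p t a b c =
  allᵇ-sound (p a b c)
    (allᵇ-sound (λ c → allᵇ (p a b c))
      (allᵇ-sound (λ b → allᵇ λ c → allᵇ (p a b c))
        (allᵇ-sound (λ a → allᵇ λ b → allᵇ λ c → allᵇ (p a b c)) t a) b) c)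

≤-by-cases⁴ : (f g : Bool → Bool → Bool → Bool → ℕ) →
  T (all⁴ λ a b c d → f a b c d ≤ᵇ g a b c d) → ∀ a b c d → f a b c d ≤ g a b c d
≤-by-cases⁴ f g t a b c d = ≤ᵇ⇒≤ _ _ (all⁴-sound (λ a b c d → f a b c d ≤ᵇ g a b c d) t a b c d)

⌊≟⌋-refl : ∀ {n} (w : Fin n) → ⌊ w ≟ w ⌋ ≡ true
⌊≟⌋-refl w = Equivalence.to T-≡ (fromWitness refl)

⌊≟⌋⇒≡ : ∀ {n} {v w : Fin n} → ⌊ v ≟ w ⌋ ≡ true → v ≡ w
⌊≟⌋⇒≡ v≟w = toWitness (Equivalence.from T-≡ v≟w)

xor-self : ∀ a → xor a a ≡ false
xor-self true  = refl
xor-self false = refl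

xor≡false⇒≡ : ∀ a b → xor a b ≡ false → a ≡ b
xor≡false⇒≡ true  true  _ = refl
xor≡false⇒≡ false false _ = refl

module _ {n : ℕ} where

  infixl 7 _∩_
  infixl 6 _∪_ _∖_

  _∩_ _∪_ _∖_ : VSet n → VSet n → VSet n
  (A ∩ B) v = A v ∧ B v
  (A ∪ B) v = A v ∨ B v
  (A ∖ B) v = A v ∧ not (B v)

  insert : Fin n → VSet n → VSet n
  insert w Y v = Y v ∨ ⌊ v ≟ w ⌋

  ConstantOn : VSet n → VSet n → Set
  ConstantOn X Y = ∃[ b ] (∀ v → X v ≡ true → Y v ≡ b)

  Cut : VSet n → VSet n → VSet n → Set
  Cut A B Y = A ⊆ Y × Disjoint B Y

  Cut-cong : ∀ {A B Y Y' : VSet n} → Y ≗ Y' → Cut A B Y → Cut A B Y'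
  Cut-cong Y≗Y' (A⊆Y , B∩Y) =
    (λ v Av → trans (sym (Y≗Y' v)) (A⊆Y v Av)) , (λ v Bv → trans (sym (Y≗Y' v)) (B∩Y v Bv))

  disjoint-⊆ : ∀ {A S X : VSet n} → Disjoint X S → A ⊆ S → Disjoint A X
  disjoint-⊆ X∩S A⊆S v Av = ¬-not λ Xv → contradiction (trans (sym (A⊆S v Av)) (X∩S v Xv)) λ ()

onEdges : ∀ {n} (G : Graph n) → (Fin n → Fin n → Bool) → ESet G
onEdges G P e = P (proj₁ (ends G e)) (proj₂ (ends G e))

boundary : ∀ {n} (G : Graph n) → VSet n → ESet G
boundary G Y = onEdges G (crossesᵇ Y)

countE-mono : ∀ {n} (G : Graph n) (P Q : Fin n → Fin n → Bool) →
              (∀ u v → 𝟙 (P u v) ≤ 𝟙 (Q u v)) → countE G P ≤ countE G Q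
countE-mono G P Q h = count-mono {p = onEdges G P} {onEdges G Q} (λ _ → h _ _) (allFin _)

countE-+-mono : ∀ {n} (G : Graph n) (P Q R S : Fin n → Fin n → Bool) →
  (∀ u v → 𝟙 (P u v) + 𝟙 (Q u v) ≤ 𝟙 (R u v) + 𝟙 (S u v)) →
  countE G P + countE G Q ≤ countE G R + countE G S
countE-+-mono G P Q R S h =
  count-+-mono {p = onEdges G P} {onEdges G Q} {onEdges G R} {onEdges G S} (λ _ → h _ _) (allFin _)

∂size-cong : ∀ {n} (G : Graph n) {Y Y' : VSet n} → Y ≗ Y' → ∂size G Y ≡ ∂size G Y'
∂size-cong G {Y} {Y'} Y≗Y' =
  count-cong {p = boundary G Y} {boundary G Y'} (λ _ → cong₂ xor (Y≗Y' _) (Y≗Y' _)) (allFin _)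

Reach-trans : ∀ {n} {G : Graph n} {F u v w} → Reach G F u v → Reach G F v w → Reach G F u w
Reach-trans here              q = q
Reach-trans (fwd e Fe refl p) q = fwd e Fe refl (Reach-trans p q)
Reach-trans (bwd e Fe refl p) q = bwd e Fe refl (Reach-trans p q)

Closed : ∀ {n} (G : Graph n) → ESet G → VSet n → Set
Closed G F Y = ∀ e → F e ≡ false → boundary G Y e ≡ false

ReachableFrom : ∀ {n} (G : Graph n) → ESet G → VSet n → VSet n → Set
ReachableFrom G F A Y = ∀ y → Y y ≡ true → ∃[ a ] A a ≡ true × Reach G F a y

Reach-closed : ∀ {n} {G : Graph n} {F Y u w} → Closed G F Y → Reach G F u w → Y u ≡ true → Y w ≡ true
Reach-closed         closed here              Yu = Yu
Reach-closed {Y = Y} closed (fwd e Fe refl p) Yu =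
  Reach-closed {Y = Y} closed p (trans (sym (xor≡false⇒≡ _ _ (closed e Fe))) Yu)
Reach-closed {Y = Y} closed (bwd e Fe refl p) Yu =
  Reach-closed {Y = Y} closed p (trans (xor≡false⇒≡ _ _ (closed e Fe)) Yu)

module _ {n} (G : Graph n) (F : ESet G) (A : VSet n) where

  private
    exit : ∀ {Y} → ReachableFrom G F A Y → ∀ e → F e ≡ false → boundary G Y e ≡ true →
           ∃[ w ] Y w ≡ false × ∃[ a ] A a ≡ true × Reach G F a w
    exit {Y} reach e Fe ∂e with Y (proj₁ (ends G e)) in Yu | Y (proj₂ (ends G e)) in Yv
    ... | true  | false = _ , Yv , map₂ (map₂ λ r → Reach-trans r (fwd e Fe refl here)) (reach _ Yu)
    ... | false | true  = _ , Yu , map₂ (map₂ λ r → Reach-trans r (bwd e Fe refl here)) (reach _ Yv)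

    insert-reachable : ∀ {Y w} → ReachableFrom G F A Y → ∃[ a ] A a ≡ true × Reach G F a w →
                       ReachableFrom G F A (insert w Y)
    insert-reachable {Y} {w} reach a↝w y Y'y with Y y in Yy
    ... | true  = reach y Yy
    ... | false with ⌊≟⌋⇒≡ Y'y
    ...   | refl = a↝w

    insert-shrinks : ∀ {Y w} → Y w ≡ false → count (not ∘ insert w Y) (allFin n) < count (not ∘ Y) (allFin n)
    insert-shrinks {Y} {w} Yw =
      count-< {p = not ∘ insert w Y} {q = not ∘ Y} outside-shrinks (∈-allFin w)
        (trans (cong (λ b → not (Y w ∨ b)) (⌊≟⌋-refl w)) (cong not (∨-zeroʳ (Y w))))
        (cong not Yw)
      where
      outside-shrinks : ∀ v → 𝟙 (not (insert w Y v)) ≤ 𝟙 (not (Y v))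
      outside-shrinks v with Y v
      ... | true  = z≤n
      ... | false = 𝟙-mono (λ _ → refl)

    grow : ∀ Y → A ⊆ Y → ReachableFrom G F A Y → Acc _<_ (count (not ∘ Y) (allFin n)) →
           ∃[ R ] A ⊆ R × ReachableFrom G F A R × Closed G F R
    grow Y A⊆Y reach (acc smaller)
      with any? (λ e → (F e Bool.≟ false) ×-dec (boundary G Y e Bool.≟ true))
    ... | no none = Y , A⊆Y , reach , λ e Fe → ¬-not λ ∂e → none (e , Fe , ∂e)
    ... | yes (e , Fe , ∂e) with exit reach e Fe ∂e
    ...   | w , Yw , a↝w =
      grow (insert w Y) (λ v Av → cong (_∨ ⌊ v ≟ w ⌋) (A⊆Y v Av)) (insert-reachable reach a↝w)
           (smaller (insert-shrinks Yw))

  reachableSet : ∃[ R ] A ⊆ R × ReachableFrom G F A R × Closed G F R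
  reachableSet = grow A (λ _ Av → Av) (λ a Aa → a , Aa , here) (<-wellFounded _)

-- Minimum cuts

≤-by-head : ∀ {n k} (f : VSet (suc n) → ℕ) → f Preserves _≗_ ⟶ _≡_ →
            (∀ b Y → k ≤ f (b V.∷ Y)) → ∀ Y → k ≤ f Y
≤-by-head f f-cong k≤f Y =
  ≤-trans (k≤f (V.head Y) (V.tail Y)) (≤-reflexive (f-cong λ { zero → refl ; (suc i) → refl }))

argmin : ∀ {n} (f : VSet n → ℕ) → f Preserves _≗_ ⟶ _≡_ → ∃[ Y ] (∀ Y' → f Y ≤ f Y')
argmin {zero} f f-cong = (λ ()) , λ _ → ≤-reflexive (f-cong λ ())
argmin {suc n} f f-cong
  with argmin (f ∘ (false V.∷_)) (f-cong ∘ ∷-cong false) | argmin (f ∘ (true V.∷_)) (f-cong ∘ ∷-cong true)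
  where
  ∷-cong : ∀ b {Y Y' : VSet n} → Y ≗ Y' → (b V.∷ Y) ≗ (b V.∷ Y')
  ∷-cong b Y≗Y' zero    = refl
  ∷-cong b Y≗Y' (suc i) = Y≗Y' i
... | Y₀ , min₀ | Y₁ , min₁ with ≤-total (f (false V.∷ Y₀)) (f (true V.∷ Y₁))
... | inj₁ f₀≤f₁ = false V.∷ Y₀ , ≤-by-head f f-cong λ
  { false → min₀ ; true → λ Y → ≤-trans f₀≤f₁ (min₁ Y) }
... | inj₂ f₁≤f₀ = true V.∷ Y₁ , ≤-by-head f f-cong λ
  { false → λ Y → ≤-trans f₁≤f₀ (min₀ Y) ; true → min₁ }

record MinCut {n} (G : Graph n) (A B : VSet n) : Set where
  field
    side    : VSet n
    isCut   : Cut A B side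
    minimal : ∀ Y → Cut A B Y → ∂size G side ≤ ∂size G Y

open MinCut

minCut : ∀ {n} (G : Graph n) {A B : VSet n} → Disjoint A B → MinCut G A B
minCut {n} G {A} {B} A∩B = record
  { side    = force Y*
  ; isCut   = force-isCut Y*
  ; minimal = λ Y cut → ≤-trans (Y*-minimal Y) (≤-reflexive (∂size-cong G (force-cut cut)))
  }
  where
  -- Minimising ∂ over all sets after forcing them to be cuts avoids restricting argmin to cuts.
  force : VSet n → VSet n
  force Y = (Y ∪ A) ∖ B

  force-isCut : ∀ Y → Cut A B (force Y)
  force-isCut Y =
    (λ v Av → trans (cong₂ (λ a b → (Y v ∨ a) ∧ not b) Av (A∩B v Av)) (cong (_∧ true) (∨-zeroʳ (Y v)))) ,
    (λ v Bv → trans (cong (λ b → (Y v ∨ A v) ∧ not b) Bv) (∧-zeroʳ _))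

  force-cut : ∀ {Y} → Cut A B Y → force Y ≗ Y
  force-cut {Y} (A⊆Y , B∩Y) v with A v in Av | B v in Bv
  ... | true  | true  = contradiction (trans (sym Bv) (A∩B v Av)) λ ()
  ... | true  | false = trans (Bool.∧-identityʳ _) (trans (∨-zeroʳ (Y v)) (sym (A⊆Y v Av)))
  ... | false | true  = trans (∧-zeroʳ _) (sym (B∩Y v Bv))
  ... | false | false = trans (Bool.∧-identityʳ _) (Bool.∨-identityʳ (Y v))

  minimiser : ∃[ Y ] (∀ Y' → ∂size G (force Y) ≤ ∂size G (force Y'))
  minimiser = argmin (∂size G ∘ force)
    (λ Y≗Y' → ∂size-cong G λ v → cong (λ b → (b ∨ A v) ∧ not (B v)) (Y≗Y' v))

  Y* : VSet n
  Y* = proj₁ minimiser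

  Y*-minimal : ∀ Y → ∂size G (force Y*) ≤ ∂size G (force Y)
  Y*-minimal = proj₂ minimiser

minCut-isMincut : ∀ {n} {G : Graph n} {A B : VSet n} (m : MinCut G A B) → IsMincut G A B (∂size G (side m))
minCut-isMincut {G = G} {A} {B} m = (boundary G (side m) , separates , refl) , lower-bound
  where
  separates : Separates G (boundary G (side m)) A B
  separates a b Aa Bb a↝b =
    contradiction (trans (sym (Reach-closed {Y = side m} (λ _ ∂e → ∂e) a↝b (proj₁ (isCut m) a Aa)))
                         (proj₂ (isCut m) b Bb)) λ ()

  lower-bound : ∀ F → Separates G F A B → ∂size G (side m) ≤ countᵇ F
  lower-bound F F-separates with reachableSet G F A
  ... | R , A⊆R , reach , closed = begin
    ∂size G (side m)  ≤⟨ minimal m R (A⊆R , B∩R) ⟩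
    ∂size G R         ≤⟨ count-mono {p = boundary G R} {q = F} ∂R⊆F (allFin _) ⟩
    countᵇ F          ∎
    where
    open ≤-Reasoning
    B∩R : Disjoint B R
    B∩R v Bv = ¬-not λ Rv → let (a , Aa , a↝v) = reach v Rv in F-separates a v Aa Bv a↝v
    ∂R⊆F : ∀ e → 𝟙 (boundary G R e) ≤ 𝟙 (F e)
    ∂R⊆F e with F e in Fe
    ... | true  = 𝟙-mono (λ _ → refl)
    ... | false = ≤-reflexive (cong 𝟙 (closed e Fe))

module _ {n n'} (ι : Fin n → Fin n') (A : VSet n) where

  image-intro : ∀ t → A t ≡ true → image ι A (ι t) ≡ true
  image-intro t At = Equivalence.to T-≡
    (any⁺ _ (lose (∈-allFin t) (Equivalence.from T-≡ (cong₂ _∧_ At (⌊≟⌋-refl (ι t))))))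

  image-elim : ∀ y → image ι A y ≡ true → ∃[ t ] A t ≡ true × ι t ≡ y
  image-elim y Iy with satisfied (any⁻ _ (allFin n) (Equivalence.from T-≡ Iy))
  ... | t , At∧ιt≡y with Equivalence.to T-∧ At∧ιt≡y
  ...   | At , ιt≡y = t , Equivalence.to T-≡ At , toWitness ιt≡y

  image-⇔ : ∀ (Z : VSet n') b → (∀ y → image ι A y ≡ true → Z y ≡ b) ⇔ (∀ t → A t ≡ true → Z (ι t) ≡ b)
  image-⇔ Z b = mk⇔
    (λ I⊆Z t At → I⊆Z (ι t) (image-intro t At))
    (λ A⊆Z∘ι y Iy → let (t , At , ιt≡y) = image-elim y Iy in subst (λ y → Z y ≡ b) ιt≡y (A⊆Z∘ι t At))

Cut-image : ∀ {n n'} (ι : Fin n → Fin n') {A B : VSet n} {Z : VSet n'} →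
            Cut (image ι A) (image ι B) Z ⇔ Cut A B (Z ∘ ι)
Cut-image ι {A} {B} {Z} = mk⇔
  (Product.map (Equivalence.to   (image-⇔ ι A Z true)) (Equivalence.to   (image-⇔ ι B Z false)))
  (Product.map (Equivalence.from (image-⇔ ι A Z true)) (Equivalence.from (image-⇔ ι B Z false)))

-- Uncrossing

-- Per-edge accounting for an edge uv, with x = X u, y = Y u, x' = X v, y' = Y v.

between≤crossing : ∀ x y x' y' →
  𝟙 (((x ∧ y) ∧ (x' ∧ not y')) ∨ ((x ∧ not y) ∧ (x' ∧ y'))) ≤ 𝟙 (xor y y')
between≤crossing = ≤-by-cases⁴ _ _ _

∖-uncrossing : ∀ x y x' y' →
  𝟙 (xor (y ∧ not x) (y' ∧ not x')) + 𝟙 (((x ∧ y) ∧ (x' ∧ not y')) ∨ ((x ∧ not y) ∧ (x' ∧ y')))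
  ≤ 𝟙 (xor y y') + 𝟙 (xor (x ∧ y) (x' ∧ y') ∧ xor x x')
∖-uncrossing = ≤-by-cases⁴ _ _ _

∪-uncrossing : ∀ x y x' y' →
  𝟙 (xor (y ∨ x) (y' ∨ x')) + 𝟙 (((x ∧ y) ∧ (x' ∧ not y')) ∨ ((x ∧ not y) ∧ (x' ∧ y')))
  ≤ 𝟙 (xor y y') + 𝟙 (xor (x ∧ not y) (x' ∧ not y') ∧ xor x x')
∪-uncrossing = ≤-by-cases⁴ _ _ _

module _ {n} (G : Graph n) (X Y : VSet n) where

  private
    between : Fin n → Fin n → Bool
    between u v = ((X ∩ Y) u ∧ (X ∖ Y) v) ∨ ((X ∖ Y) u ∧ (X ∩ Y) v)

    crossesᵇ-with-X : VSet n → Fin n → Fin n → Bool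
    crossesᵇ-with-X Z u v = crossesᵇ Z u v ∧ crossesᵇ X u v

  Esize-split≤∂size : Esize G (X ∩ Y) (X ∖ Y) ≤ ∂size G Y
  Esize-split≤∂size = countE-mono G between (crossesᵇ Y) λ u v →
    between≤crossing (X u) (Y u) (X v) (Y v)

  ∂size-∖-uncrossing :
    ∂size G (Y ∖ X) + Esize G (X ∩ Y) (X ∖ Y) ≤ ∂size G Y + ∂∩∂size G (X ∩ Y) X
  ∂size-∖-uncrossing =
    countE-+-mono G (crossesᵇ (Y ∖ X)) between (crossesᵇ Y) (crossesᵇ-with-X (X ∩ Y)) λ u v →
      ∖-uncrossing (X u) (Y u) (X v) (Y v)

  ∂size-∪-uncrossing :
    ∂size G (Y ∪ X) + Esize G (X ∩ Y) (X ∖ Y) ≤ ∂size G Y + ∂∩∂size G (X ∖ Y) X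
  ∂size-∪-uncrossing =
    countE-+-mono G (crossesᵇ (Y ∪ X)) between (crossesᵇ Y) (crossesᵇ-with-X (X ∖ Y)) λ u v →
      ∪-uncrossing (X u) (Y u) (X v) (Y v)

  split-partition : IsPartition X (X ∩ Y) (X ∖ Y)
  split-partition = (λ v → rejoin (X v) (Y v)) , (λ v → separate (X v) (Y v))
    where
    rejoin : ∀ x y → (x ∧ y) ∨ (x ∧ not y) ≡ x
    rejoin true  true  = refl
    rejoin true  false = refl
    rejoin false _     = refl
    separate : ∀ x y → x ∧ y ≡ true → x ∧ not y ≡ false
    separate true true _ = refl

⊓-≤-either : ∀ {m k e} → m ⊓ k ≤ e → m ≤ e ⊎ k ≤ e
⊓-≤-either {m} {k} m⊓k≤e with ⊓-sel m k
... | inj₁ m⊓k≡m = inj₁ (subst (_≤ _) m⊓k≡m m⊓k≤e)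
... | inj₂ m⊓k≡k = inj₂ (subst (_≤ _) m⊓k≡k m⊓k≤e)

uncross : ∀ {n c} {G : Graph n} {X : VSet n} → Linked c G X → ∀ Y → ∂size G Y < c →
          ∂size G (Y ∖ X) ≤ ∂size G Y ⊎ ∂size G (Y ∪ X) ≤ ∂size G Y
uncross {c = c} {G} {X} linked Y ∂Y<c =
  Sum.map (absorb (∂size-∖-uncrossing G X Y)) (absorb (∂size-∪-uncrossing G X Y)) side≤E
  where
  E = Esize G (X ∩ Y) (X ∖ Y)

  side≤E : ∂∩∂size G (X ∩ Y) X ≤ E ⊎ ∂∩∂size G (X ∖ Y) X ≤ E
  side≤E with ⊓-≤-either (linked (X ∩ Y) (X ∖ Y) (split-partition G X Y))
  ... | inj₁ min≤E = ⊓-≤-either min≤E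
  ... | inj₂ c≤E   = contradiction c≤E (<⇒≱ (≤-<-trans (Esize-split≤∂size G X Y) ∂Y<c))

  absorb : ∀ {a b s} → a + E ≤ b + s → s ≤ E → a ≤ b
  absorb {a} {b} a+E≤b+s s≤E = +-cancelʳ-≤ E a b (≤-trans a+E≤b+s (+-monoʳ-≤ b s≤E))

uncross-cut : ∀ {n c} {G : Graph n} {X A B Y : VSet n} → Linked c G X →
              Disjoint A X → Disjoint B X → Cut A B Y → ∂size G Y < c →
              ∃[ Y' ] Cut A B Y' × ConstantOn X Y' × ∂size G Y' ≤ ∂size G Y
uncross-cut {G = G} {X} {A} {B} {Y} linked A∩X B∩X (A⊆Y , B∩Y) ∂Y<c with uncross {G = G} linked Y ∂Y<c
... | inj₁ ∂Y∖X≤∂Y = Y ∖ X ,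
  ( (λ v Av → cong₂ (λ y x → y ∧ not x) (A⊆Y v Av) (A∩X v Av))
  , (λ v Bv → cong (_∧ not (X v)) (B∩Y v Bv)) ) ,
  (false , λ v Xv → trans (cong (λ x → Y v ∧ not x) Xv) (∧-zeroʳ (Y v))) ,
  ∂Y∖X≤∂Y
... | inj₂ ∂Y∪X≤∂Y = Y ∪ X ,
  ( (λ v Av → cong (_∨ X v) (A⊆Y v Av))
  , (λ v Bv → cong₂ _∨_ (B∩Y v Bv) (B∩X v Bv)) ) ,
  (true , λ v Xv → trans (cong (Y v ∨_) Xv) (∨-zeroʳ (Y v))) ,
  ∂Y∪X≤∂Y

-- Contraction

not-∧≡false : ∀ a b → not (a ∧ b) ≡ false → a ≡ true × b ≡ true
not-∧≡false true true _ = refl , refl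

X-closed-in-G[X] : ∀ {n} (G : Graph n) (X : VSet n) → Closed G (λ e → not (inXᵇ X (ends G e))) X
X-closed-in-G[X] G X e inX =
  let (Xu , Xv) = not-∧≡false (X (proj₁ (ends G e))) (X (proj₂ (ends G e))) inX in cong₂ xor Xu Xv

ConnIn-X : ∀ {n} {G : Graph n} {X : VSet n} {u w} → ConnIn G X u w → u ≡ w ⊎ (X u ≡ true × X w ≡ true)
ConnIn-X here = inj₁ refl
ConnIn-X {G = G} {X} p@(fwd e inX refl _) =
  let Xu = proj₁ (not-∧≡false _ _ inX) in inj₂ (Xu , Reach-closed {Y = X} (X-closed-in-G[X] G X) p Xu)
ConnIn-X {G = G} {X} p@(bwd e inX refl _) =
  let Xu = proj₂ (not-∧≡false _ _ inX) in inj₂ (Xu , Reach-closed {Y = X} (X-closed-in-G[X] G X) p Xu)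

module Contraction {n n'} (G : Graph n) (X : VSet n) (π : Fin n → Fin n')
                   (isπ : IsContractionMap G X π) where

  H : Graph n'
  H = contract G X π

  π-fibre : ∀ {u v} → π u ≡ π v → u ≡ v ⊎ (X u ≡ true × X v ≡ true)
  π-fibre {u} {v} πu≡πv = [ inj₁ , ConnIn-X ]′ (Equivalence.to (proj₂ isπ u v) πu≡πv)

  π-contracts : ∀ e → inXᵇ X (ends G e) ≡ true → π (proj₁ (ends G e)) ≡ π (proj₂ (ends G e))
  π-contracts e inX = Equivalence.from (proj₂ isπ _ _) (inj₂ (fwd e (cong not inX) refl here))

  ∂size-contract : ∀ Z → ∂size H Z ≡ ∂size G (Z ∘ π)
  ∂size-contract Z = begin
    ∂size H Z                                 ≡⟨ count-lookup crosses H ⟩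
    count crosses H                           ≡⟨ count-map crosses π² (filterᵇ outside G) ⟩
    count (crosses ∘ π²) (filterᵇ outside G)  ≡⟨ count-filterᵇ (crosses ∘ π²) outside G ⟩
    count kept G                              ≡⟨ count-lookup kept G ⟨
    count (kept ∘ lookup G) (allFin _)        ≡⟨ count-cong kept≗crossing (allFin _) ⟩
    ∂size G (Z ∘ π)                           ∎
    where
    open ≡-Reasoning
    crosses : Fin n' × Fin n' → Bool
    crosses = uncurry (crossesᵇ Z)
    π² : Fin n × Fin n → Fin n' × Fin n'
    π² (u , v) = π u , π v
    outside : Fin n × Fin n → Bool
    outside uv = not (inXᵇ X uv)
    kept : Fin n × Fin n → Bool
    kept uv = outside uv ∧ crosses (π² uv)
    kept≗crossing : kept ∘ lookup G ≗ boundary G (Z ∘ π)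
    kept≗crossing e with inXᵇ X (ends G e) in inX
    ... | false = refl
    ... | true  = sym (trans (cong (λ z → xor (Z z) (Z (π (proj₂ (ends G e))))) (π-contracts e inX))
                             (xor-self (Z (π (proj₂ (ends G e))))))

  factor : ∀ {Y} → ConstantOn X Y → ∃[ Z ] (∀ v → Z (π v) ≡ Y v)
  factor {Y} (b , Y≡b) = Y ∘ section , λ v →
    [ cong Y , (λ (Xs , Xv) → trans (Y≡b _ Xs) (sym (Y≡b v Xv))) ]′ (π-fibre (π∘section (π v)))
    where
    section : Fin n' → Fin n
    section w = proj₁ (proj₁ isπ w)
    π∘section : ∀ w → π (section w) ≡ w
    π∘section w = proj₂ (proj₁ isπ w) refl

  image-disjoint : ∀ {A B} → Disjoint A X → Disjoint A B → Disjoint (image π A) (image π B)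
  image-disjoint {A} {B} A∩X A∩B y A'y = ¬-not λ B'y →
    let (t  , At  , πt≡y)  = image-elim π A y A'y
        (t' , Bt' , πt'≡y) = image-elim π B y B'y
    in [ (λ t≡t' → contradiction (trans (sym Bt') (subst (λ s → B s ≡ false) t≡t' (A∩B t At))) λ ())
       , (λ (Xt , _) → contradiction (trans (sym Xt) (A∩X t At)) λ ()) ]′
       (π-fibre (trans πt≡y (sym πt'≡y)))

  module _ {A B : VSet n} (mG : MinCut G A B) (mH : MinCut H (image π A) (image π B)) where

    mincut≤mincut-contract : ∂size G (side mG) ≤ ∂size H (side mH)
    mincut≤mincut-contract = begin
      ∂size G (side mG)      ≤⟨ minimal mG _ (Equivalence.to (Cut-image π) (isCut mH)) ⟩
      ∂size G (side mH ∘ π)  ≡⟨ ∂size-contract (side mH) ⟨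
      ∂size H (side mH)      ∎
      where open ≤-Reasoning

    mincut-contract≤mincut : ∀ {c} → Linked c G X → Disjoint A X → Disjoint B X →
                             ∂size G (side mG) < c → ∂size H (side mH) ≤ ∂size G (side mG)
    mincut-contract≤mincut linked A∩X B∩X ∂<c with uncross-cut {G = G} linked A∩X B∩X (isCut mG) ∂<c
    ... | Y , cut , constant , ∂Y≤ with factor constant
    ...   | Z , Z∘π≗Y = begin
      ∂size H (side mH)  ≤⟨ minimal mH Z (Equivalence.from (Cut-image π) (Cut-cong (sym ∘ Z∘π≗Y) cut)) ⟩
      ∂size H Z          ≡⟨ ∂size-contract Z ⟩
      ∂size G (Z ∘ π)    ≡⟨ ∂size-cong G Z∘π≗Y ⟩
      ∂size G Y          ≤⟨ ∂Y≤ ⟩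
      ∂size G (side mG)  ∎
      where open ≤-Reasoning

⊓-agree : ∀ {c k l} → k ≤ l → (k < c → l ≤ k) → l ⊓ c ≡ k ⊓ c
⊓-agree {c} {k} {l} k≤l l≤k-below-c with c ≤? k
... | yes c≤k = trans (m≥n⇒m⊓n≡n (≤-trans c≤k k≤l)) (sym (m≥n⇒m⊓n≡n c≤k))
... | no  c≰k = cong (_⊓ c) (≤-antisym (l≤k-below-c (≰⇒> c≰k)) k≤l)

mainTheorem2 : (c : ℕ) → c ≥ 1 → (n : ℕ) (G : Graph n) (T : VSet n) →
    TerminalCondition G T →
    (X : VSet n) → (∀ v → X v ≡ true → T v ≡ false) →
    Linked c G X →
    (n' : ℕ) (π : Fin n → Fin n') → IsContractionMap G X π →
    IsMimicking c G T (contract G X π) π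
mainTheorem2 c _ n G T _ X X∩T linked n' π isπ A B A⊆T B⊆T A∩B =
  ∂size G (side mG) , ∂size H (side mH) , minCut-isMincut mG , minCut-isMincut mH ,
  ⊓-agree (mincut≤mincut-contract mG mH) (mincut-contract≤mincut mG mH linked A∩X B∩X)
  where
  open Contraction G X π isπ
  A∩X : Disjoint A X
  A∩X = disjoint-⊆ X∩T A⊆T
  B∩X : Disjoint B X
  B∩X = disjoint-⊆ X∩T B⊆T
  mG : MinCut G A B
  mG = minCut G A∩B
  mH : MinCut H (image π A) (image π B)
  mH = minCut H (image-disjoint A∩X A∩B)
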